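{- Let $\mathcal S=(\mathcal P,\mathcal L,\mathrm I)$ be a finite generalized quadrangle of order $(s,t)$, let $\Omega$ be its set of flags, and let $R_0,\dots,R_7$ be the relations on $\Omega$ defined in the context. Then $\mathcal X=(\Omega,\{R_i\}_{i=0}^{7})$ is a noncommutative, imprimitive association scheme of order $(s+1)(t+1)(st+1)$ and class $7$. Moreover, its intersection numbers $p^k_{ij}$ are polynomials in $s$ and $t$.
   Context: A finite generalized quadrangle of order $(s,t)$ ($s,t\ge 1$ integers) is an incidence structure $\mathcal S=(\mathcal P,\mathcal L,\mathrm I)$ with disjoint nonempty finite sets of points $\mathcal P$ and lines $\mathcal L$ and a symmetric incidence relation $\mathrm I$ such that: each point is incident with $t+1$ lines and two distinct points are incident with at most one common line; each line is incident with $s+1$ points and two distinct lines are incident with at most one common point; if $p$ is a point and $L$ a line not incident with $p$, there is a unique pair $(q,M)\in\mathcal P\times\mathcal L$ with $p\,\mathrm I\,M\,\mathrm I\,q\,\mathrm I\,L$. A flag is a pair $(p,L)\in\mathcal P\times\mathcal L$ with $p\,\mathrm I\,L$; $\Omega$ denotes the set of flags. Relations on $\Omega$: $R_0$ is the diagonal; $((p,L),(q,M))\in R_1$ iff $p=q$, $L\ne M$; $\in R_2$ iff $L=M$, $p\ne q$; $\in R_3$ iff $p\neq q$ are collinear on $L$ (i.e. $q\,\mathrm I\,L$, $q\ne p$, and $M\neq L$); $\in R_4$ iff $p\neq q$ are collinear on $M$ (with $L\neq M$); $\in R_5$ iff $p\ne q$ are collinear but the joining line is neither $L$ nor $M$;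 $\in R_6$ iff $L$ and $M$ are distinct lines meeting in a point $r$ with $r\ne p$ and $r\neq q$; $\in R_7$ iff $L$ and $M$ have no common point and $p,q$ are not collinear. An association scheme is a pair $(X,\{R_i\}_{i\in I})$ with $\{R_i\}$ a partition of $X\times X$ containing the diagonal $R_0$, closed under taking converses, such that for all $i,j,k$ the number $p^k_{ij}$ of $z$ with $(x,z)\in R_i$, $(z,y)\in R_j$ depends only on $k$ for $(x,y)\in R_k$. Its order is $|X|$, its class is the number of non-diagonal relations; it is commutative if $p^k_{ij}=p^k_{ji}$ for all $i,j,k$; it is imprimitive if some union of basis relations, other than $R_0$ and $X\times X$, is an equivalence relation. -}

module Defs where

open import Data.Nat using (ℕ; zero; suc; _+_; _*_; _<_)
open import Data.Integer as ℤ using (ℤ)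
open import Data.Fin using (Fin; zero; suc)
open import Data.Bool using (Bool; T)
open import Data.List using (List; length)
open import Data.List.Membership.Propositional using (_∈_)
open import Data.List.Relation.Unary.Unique.Propositional using (Unique)
open import Data.Product using (Σ; ∃; ∃-syntax; _×_; _,_; proj₁; proj₂)
open import Data.Unit using (⊤)
open import Data.Empty using (⊥)
open import Relation.Nullary using (¬_)
open import Relation.Binary.PropositionalEquality using (_≡_; _≢_)
open import Function.Bundles using (_⇔_)

HasSize : {X : Set} → (X → Set) → ℕ → Set
HasSize {X} P n =
  Σ (List X) λ zs → Unique zs × length zs ≡ n × (∀ z → (z ∈ zs) ⇔ P z)

record IsAssociationScheme {X : Set} (d : ℕ) (R : Fin (suc d) → X → X → Set) : Set where
  field
    cover     : ∀ x y → ∃[ i ] R i x y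
    disjoint  : ∀ i j x y → R i x y → R j x y → i ≡ j
    nonempty  : ∀ i → ∃[ x ] ∃[ y ] R i x y
    diagonal  : ∀ x y → R zero x y ⇔ (x ≡ y)
    converse  : ∀ i → ∃[ j ] (∀ x y → R i x y ⇔ R j y x)
    p         : Fin (suc d) → Fin (suc d) → Fin (suc d) → ℕ
    p-correct : ∀ i j k x y → R k x y →
                HasSize (λ z → R i x z × R j z y) (p i j k)

  HasOrder : ℕ → Set
  HasOrder n = HasSize {X} (λ _ → ⊤) n

  Commutative : Set
  Commutative = ∀ i j k → p i j k ≡ p j i k

Imprimitive : {X : Set} (d : ℕ) (R : Fin (suc d) → X → X → Set) → Set
Imprimitive {X} d R =
  Σ (Fin (suc d) → Bool) λ S →
    let U : X → X → Set
        U x y = ∃[ i ] (T (S i) × R i x y)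
    in  ¬ (∀ x y → U x y ⇔ (x ≡ y))
      × ¬ (∀ x y → U x y)
      × (∀ x → U x x)
      × (∀ x y → U x y → U y x)
      × (∀ x y z → U x y → U y z → U x z)

record GQ (s t : ℕ) : Set where
  field
    np nl : ℕ
    inc   : Fin np → Fin nl → Bool

  _I_ : Fin np → Fin nl → Set
  x I L = T (inc x L)

  field
    points-nonempty : 0 < np
    lines-nonempty  : 0 < nl
    lines-per-point : ∀ x → HasSize (λ L → x I L) (suc t)
    points-per-line : ∀ L → HasSize (λ x → x I L) (suc s)
    two-points      : ∀ x y → x ≢ y → ∀ L M →
                      x I L → y I L → x I M → y I M → L ≡ M
    two-lines       : ∀ L M → L ≢ M → ∀ x y →
                      x I L → x I M → y I L → y I M → x ≡ y
    gq-axiom        : ∀ x L → ¬ (x I L) →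
                      Σ (Fin np × Fin nl) λ qM →
                        (x I proj₂ qM × proj₁ qM I proj₂ qM × proj₁ qM I L)
                        × (∀ q' M' → x I M' → q' I M' → q' I L →
                             q' ≡ proj₁ qM × M' ≡ proj₂ qM)

  Flag : Set
  Flag = Σ (Fin np × Fin nl) λ xL → proj₁ xL I proj₂ xL

  pt : Flag → Fin np
  pt f = proj₁ (proj₁ f)

  ln : Flag → Fin nl
  ln f = proj₂ (proj₁ f)

  Collinear : Fin np → Fin np → Set
  Collinear x y = ∃[ N ] (x I N × y I N)

  Rel : Fin 8 → Flag → Flag → Set
  Rel zero a b = a ≡ b
  Rel (suc zero) a b = pt a ≡ pt b × ln a ≢ ln b
  Rel (suc (suc zero)) a b = ln a ≡ ln b × pt a ≢ pt b
  Rel (suc (suc (suc zero))) a b =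
    pt a ≢ pt b × pt b I ln a × ln b ≢ ln a
  Rel (suc (suc (suc (suc zero)))) a b =
    pt a ≢ pt b × pt a I ln b × ln a ≢ ln b
  Rel (suc (suc (suc (suc (suc zero))))) a b =
    pt a ≢ pt b × ∃[ N ] (pt a I N × pt b I N × N ≢ ln a × N ≢ ln b)
  Rel (suc (suc (suc (suc (suc (suc zero)))))) a b =
    ln a ≢ ln b × ∃[ r ] (r I ln a × r I ln b × r ≢ pt a × r ≢ pt b)
  Rel (suc (suc (suc (suc (suc (suc (suc zero))))))) a b =
    ¬ (∃[ r ] (r I ln a × r I ln b)) × ¬ Collinear (pt a) (pt b)

data Poly₂ : Set where
  const : ℤ → Poly₂
  var-s : Poly₂
  var-t : Poly₂
  _⊕_   : Poly₂ → Poly₂ → Poly₂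
  _⊗_   : Poly₂ → Poly₂ → Poly₂

eval : Poly₂ → ℤ → ℤ → ℤ
eval (const c) s t = c
eval var-s s t = s
eval var-t s t = t
eval (P ⊕ Q) s t = eval P s t ℤ.+ eval Q s t
eval (P ⊗ Q) s t = eval P s t ℤ.* eval Q s t

{-# OPTIONS --safe #-}
module Submission where

-- The flags of a generalized quadrangle of order (s, t) form a building of type C₂: its
-- Weyl group is the dihedral group ⟨σ₁, σ₂⟩ of order 8, and R₀, …, R₇ are the eight values
-- of the Weyl distance.  Let x, y be at distance k and a be a generator, with q_a = t for
-- σ₁ and q_a = s for σ₂.  If ℓ(a·k) > ℓ(k), all q_a flags a-adjacent to x are at distance
-- a·k from y.  Otherwise exactly one of them (the projection of y) is, and the other
-- q_a − 1 are at distance k.  Hence, for a reduced word i = a·i′, every pair in R_i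
-- factors uniquely as an R_a-step followed by an R_{i′}-pair, so
-- p^k_{ij} = Σ_l p^k_{al} p^l_{i′j}.  Induction on reduced words then makes every p^k_{ij}
-- a polynomial in s, t, s − 1 and t − 1.  The scheme is noncommutative because
-- p^4_{12} = 1 ≠ 0 = p^4_{21}, and imprimitive because R₀ ∪ R₁ ("same point") is an
-- equivalence relation.

open import Defs
open import Data.Bool using (Bool; true; false; T; not; if_then_else_)
import Data.Bool.Properties as Bool
open import Data.Bool.Properties using (T-irrelevant)
open import Data.Empty using (⊥; ⊥-elim)
open import Data.Fin using (Fin; zero; suc; toℕ; fromℕ<)
import Data.Fin.Properties as Fin
open import Data.Fin.Properties using (_≟_; any?)
open import Data.Integer as ℤ using (+_; -[1+_])
import Data.Integer.Properties as ℤ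
open import Data.List using (List; []; _∷_; _++_; length; filter; tabulate)
open import Data.List.Properties using (length-++; filter-accept; filter-reject; filter-all)
open import Data.List.Membership.Propositional using (_∈_)
open import Data.List.Membership.Propositional.Properties
  using (∈-++⁺ˡ; ∈-++⁺ʳ; ∈-++⁻; ∈-filter⁺; ∈-filter⁻)
open import Data.List.Relation.Unary.All as All using (All; []; _∷_)
open import Data.List.Relation.Unary.Any using (here; there)
open import Data.List.Relation.Unary.AllPairs using ([]; _∷_)
open import Data.List.Relation.Unary.Unique.Propositional using (Unique)
import Data.List.Relation.Unary.Unique.Propositional.Properties as Unique
open import Data.Nat using (ℕ; zero; suc; _+_; _*_; _∸_; _≥_; _<ᵇ_; s≤s; z≤n)
open import Data.Nat.ListAction using (sum)
open import Data.Nat.Properties using (*-comm; *-identityʳ; <⇒<ᵇ)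
open import Data.Nat.Solver using (module +-*-Solver)
open import Data.Product using (Σ; ∃-syntax; _×_; _,_; proj₁; proj₂)
open import Data.Sum as ⊎ using (_⊎_; inj₁; inj₂)
open import Data.Unit using (⊤; tt)
open import Function using (_∘_)
open import Function.Bundles using (_⇔_; mk⇔; Equivalence)
import Function.Properties.Equivalence as ⇔
open import Relation.Binary.Definitions using (DecidableEquality; tri<; tri≈; tri>)
open import Relation.Binary.PropositionalEquality
  using (_≡_; _≢_; refl; sym; trans; cong; cong₂; subst; ≢-sym)
open import Relation.Nullary using (¬_; Dec; yes; no; does; ¬?)
open import Relation.Nullary.Decidable using (T?; _×-dec_; True; toWitness)

open Equivalence using (to; from)

module _ {A : Set} where

  HasSize-resp : ∀ {P Q : A → Set} {n} → (∀ z → P z ⇔ Q z) → HasSize P n → HasSize Q n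
  HasSize-resp P⇔Q (zs , unique , length≡ , ∈⇔P) =
    zs , unique , length≡ , λ z → ⇔.trans (∈⇔P z) (P⇔Q z)

  HasSize-∅ : ∀ {P : A → Set} → (∀ z → ¬ P z) → HasSize P 0
  HasSize-∅ ¬P = [] , [] , refl , λ z → mk⇔ (λ ()) (⊥-elim ∘ ¬P z)

  HasSize-singleton : (a : A) → HasSize (_≡ a) 1
  HasSize-singleton a =
    a ∷ [] , [] ∷ [] , refl , λ z → mk⇔ (λ { (here z≡a) → z≡a ; (there ()) }) here

  HasSize-witness : ∀ {P : A → Set} {n} → HasSize P n → n ≥ 1 → Σ A P
  HasSize-witness ([] , _ , refl , _) ()
  HasSize-witness (z ∷ _ , _ , _ , ∈⇔P) _ = z , to (∈⇔P z) (here refl)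

  HasSize-⊎ : ∀ {P Q : A → Set} {m n} → HasSize P m → HasSize Q n →
              (∀ z → P z → ¬ Q z) → HasSize (λ z → P z ⊎ Q z) (m + n)
  HasSize-⊎ (xs , xs-unique , refl , ∈⇔P) (ys , ys-unique , refl , ∈⇔Q) P∩Q=∅ =
    xs ++ ys ,
    Unique.++⁺ xs-unique ys-unique
      (λ { {z} (z∈xs , z∈ys) → P∩Q=∅ z (to (∈⇔P z) z∈xs) (to (∈⇔Q z) z∈ys) }) ,
    length-++ xs ,
    λ z → mk⇔ (⊎.map (to (∈⇔P z)) (to (∈⇔Q z)) ∘ ∈-++⁻ xs)
              (λ { (inj₁ p) → ∈-++⁺ˡ (from (∈⇔P z) p)
                 ; (inj₂ q) → ∈-++⁺ʳ xs (from (∈⇔Q z) q) })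

  module _ (_≟ᴬ_ : DecidableEquality A) where

    private
      _≢?_ : ∀ a z → Dec (z ≢ a)
      a ≢? z = ¬? (z ≟ᴬ a)

    length-filter-≢ : ∀ {a zs} → Unique zs → a ∈ zs →
                      suc (length (filter (a ≢?_) zs)) ≡ length zs
    length-filter-≢ {a} (a∉zs ∷ _) (here refl) =
      cong (suc ∘ length) (trans (filter-reject (a ≢?_) (λ a≢a → a≢a refl))
                                 (filter-all (a ≢?_) (All.map ≢-sym a∉zs)))
    length-filter-≢ {a} (x∉zs ∷ zs-unique) (there a∈zs) =
      cong suc (trans (cong length (filter-accept (a ≢?_) (All.lookup x∉zs a∈zs)))
                      (length-filter-≢ zs-unique a∈zs))

    HasSize-remove : ∀ {P : A → Set} {n} a → P a → HasSize P n →
                     HasSize (λ z → P z × z ≢ a) (n ∸ 1)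
    HasSize-remove a pa (zs , unique , refl , ∈⇔P) =
      filter (a ≢?_) zs ,
      Unique.filter⁺ (a ≢?_) unique ,
      cong (_∸ 1) (length-filter-≢ unique (from (∈⇔P a) pa)) ,
      λ z → mk⇔ (λ z∈ → let (z∈zs , z≢a) = ∈-filter⁻ (a ≢?_) z∈ in to (∈⇔P z) z∈zs , z≢a)
                (λ (pz , z≢a) → ∈-filter⁺ (a ≢?_) (from (∈⇔P z) pz) z≢a)

module _ {A B : Set} where

  HasSize-Σ : ∀ {W : A → Set} {F : A → B → Set} {m n} → HasSize W m →
              (∀ a → W a → HasSize (F a) n) →
              (∀ a a′ z → W a → W a′ → F a z → F a′ z → a ≡ a′) →
              HasSize (λ z → ∃[ a ] (W a × F a z)) (m * n)
  HasSize-Σ {W} {F} {n = n} (as , as-unique , refl , ∈⇔W) fibre fibres-disjoint =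
    HasSize-resp (λ z → mk⇔ (λ (a , a∈ , f) → a , to (∈⇔W a) a∈ , f)
                            (λ (a , w , f) → a , from (∈⇔W a) w , f))
                 (over as as-unique (All.tabulate (λ {a} → to (∈⇔W a))))
    where
    over : (as : List A) → Unique as → All W as →
           HasSize (λ z → ∃[ a ] (a ∈ as × F a z)) (length as * n)
    over [] _ _ = HasSize-∅ (λ { z (_ , () , _) })
    over (a ∷ as) (a∉as ∷ as-unique) (wa ∷ was) =
      HasSize-resp
        (λ z → mk⇔ (λ { (inj₁ f) → a , here refl , f
                      ; (inj₂ (a′ , a′∈ , f)) → a′ , there a′∈ , f })
                   (λ { (_ , here refl , f) → inj₁ f
                      ; (a′ , there a′∈ , f) → inj₂ (a′ , a′∈ , f) }))
        (HasSize-⊎ (fibre a wa) (over as as-unique was)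
           (λ z f (a′ , a′∈ , f′) →
              All.lookup a∉as a′∈ (fibres-disjoint a a′ z wa (All.lookup was a′∈) f f′)))

module _ {B : Set} where

  HasSize-∃Fin : ∀ {k} {Q : Fin k → B → Set} {f : Fin k → ℕ} →
                 (∀ l → HasSize (Q l) (f l)) →
                 (∀ l l′ z → Q l z → Q l′ z → l ≡ l′) →
                 HasSize (λ z → ∃[ l ] Q l z) (sum (tabulate f))
  HasSize-∃Fin {zero} _ _ = HasSize-∅ (λ { z (() , _) })
  HasSize-∃Fin {suc k} size disjoint =
    HasSize-resp (λ z → mk⇔ (λ { (inj₁ q) → zero , q ; (inj₂ (l , q)) → suc l , q })
                            (λ { (zero , q) → inj₁ q ; (suc l , q) → inj₂ (l , q) }))
      (HasSize-⊎ (size zero)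
         (HasSize-∃Fin (size ∘ suc)
            (λ l l′ z q q′ → Fin.suc-injective (disjoint (suc l) (suc l′) z q q′)))
         (λ z q (l , q′) → Fin.0≢1+n (disjoint zero (suc l) z q q′)))

-- R_i is the Weyl distance given by the i-th of 1, σ₁, σ₂, σ₂σ₁, σ₁σ₂, σ₁σ₂σ₁, σ₂σ₁σ₂,
-- σ₁σ₂σ₁σ₂, where σ₁ changes the line of a flag and σ₂ its point.
pattern r₀ = zero
pattern r₁ = suc zero
pattern r₂ = suc (suc zero)
pattern r₃ = suc (suc (suc zero))
pattern r₄ = suc (suc (suc (suc zero)))
pattern r₅ = suc (suc (suc (suc (suc zero))))
pattern r₆ = suc (suc (suc (suc (suc (suc zero)))))
pattern r₇ = suc (suc (suc (suc (suc (suc (suc zero))))))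

data Gen : Set where
  σ₁ σ₂ : Gen

gen : Gen → Fin 8
gen σ₁ = r₁
gen σ₂ = r₂

_·_ : Gen → Fin 8 → Fin 8
σ₁ · r₀ = r₁
σ₁ · r₁ = r₀
σ₁ · r₂ = r₄
σ₁ · r₃ = r₅
σ₁ · r₄ = r₂
σ₁ · r₅ = r₃
σ₁ · r₆ = r₇
σ₁ · r₇ = r₆
σ₂ · r₀ = r₂
σ₂ · r₁ = r₃
σ₂ · r₂ = r₀
σ₂ · r₃ = r₁
σ₂ · r₄ = r₆
σ₂ · r₅ = r₇
σ₂ · r₆ = r₄
σ₂ · r₇ = r₅

_⁻¹ : Fin 8 → Fin 8
r₃ ⁻¹ = r₄
r₄ ⁻¹ = r₃
i ⁻¹ = i

wordLength : Fin 8 → ℕ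
wordLength r₀ = 0
wordLength r₁ = 1
wordLength r₂ = 1
wordLength r₃ = 2
wordLength r₄ = 2
wordLength r₅ = 3
wordLength r₆ = 3
wordLength r₇ = 4

ascends : Gen → Fin 8 → Bool
ascends a k = wordLength k <ᵇ wordLength (a · k)

∀-by-evaluation : {P : Fin 8 → Set} (P? : ∀ k → Dec (P k)) {_ : True (Fin.all? P?)} → ∀ k → P k
∀-by-evaluation _ {holds} = toWitness holds

·-involutive : ∀ a k → a · (a · k) ≡ k
·-involutive σ₁ = ∀-by-evaluation λ k → σ₁ · (σ₁ · k) ≟ k
·-involutive σ₂ = ∀-by-evaluation λ k → σ₂ · (σ₂ · k) ≟ k

·-fixed-point-free : ∀ a k → a · k ≢ k
·-fixed-point-free σ₁ = ∀-by-evaluation λ k → ¬? (σ₁ · k ≟ k)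
·-fixed-point-free σ₂ = ∀-by-evaluation λ k → ¬? (σ₂ · k ≟ k)

ascends-· : ∀ a k → ascends a (a · k) ≡ not (ascends a k)
ascends-· σ₁ = ∀-by-evaluation λ k → ascends σ₁ (σ₁ · k) Bool.≟ not (ascends σ₁ k)
ascends-· σ₂ = ∀-by-evaluation λ k → ascends σ₂ (σ₂ · k) Bool.≟ not (ascends σ₂ k)

⁻¹-involutive : ∀ i → (i ⁻¹) ⁻¹ ≡ i
⁻¹-involutive = ∀-by-evaluation λ i → (i ⁻¹) ⁻¹ ≟ i

data ReducedWord : Fin 8 → Set where
  []  : ReducedWord r₀
  _∷_ : ∀ {k} (a : Gen) {_ : T (ascends a k)} → ReducedWord k → ReducedWord (a · k)

reducedWord : ∀ i → ReducedWord i
reducedWord r₀ = []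
reducedWord r₁ = σ₁ ∷ []
reducedWord r₂ = σ₂ ∷ []
reducedWord r₃ = σ₂ ∷ σ₁ ∷ []
reducedWord r₄ = σ₁ ∷ σ₂ ∷ []
reducedWord r₅ = σ₁ ∷ σ₂ ∷ σ₁ ∷ []
reducedWord r₆ = σ₂ ∷ σ₁ ∷ σ₂ ∷ []
reducedWord r₇ = σ₁ ∷ σ₂ ∷ σ₁ ∷ σ₂ ∷ []

order : Gen → ℕ → ℕ → ℕ
order σ₁ s t = t
order σ₂ s t = s

infixl 6 _⊞_
infixl 7 _⊠_

data Expr : Set where
  con       : ℕ → Expr
  ord ord∸1 : Gen → Expr
  _⊞_ _⊠_   : Expr → Expr → Expr

⟦_⟧ : Expr → ℕ → ℕ → ℕ
⟦ con n ⟧ s t = n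
⟦ ord a ⟧ s t = order a s t
⟦ ord∸1 a ⟧ s t = order a s t ∸ 1
⟦ e ⊞ e′ ⟧ s t = ⟦ e ⟧ s t + ⟦ e′ ⟧ s t
⟦ e ⊠ e′ ⟧ s t = ⟦ e ⟧ s t * ⟦ e′ ⟧ s t

∑ : ∀ {n} → (Fin n → Expr) → Expr
∑ {zero} f = con 0
∑ {suc n} f = f zero ⊞ ∑ (f ∘ suc)

⟦∑⟧ : ∀ {n} (f : Fin n → Expr) s t → ⟦ ∑ f ⟧ s t ≡ sum (tabulate λ l → ⟦ f l ⟧ s t)
⟦∑⟧ {zero} f s t = refl
⟦∑⟧ {suc n} f s t = cong (_+_ (⟦ f zero ⟧ s t)) (⟦∑⟧ (f ∘ suc) s t)

orderPoly : Gen → Poly₂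
orderPoly σ₁ = var-t
orderPoly σ₂ = var-s

toPoly₂ : Expr → Poly₂
toPoly₂ (con n) = const (+ n)
toPoly₂ (ord a) = orderPoly a
toPoly₂ (ord∸1 a) = orderPoly a ⊕ const -[1+ 0 ]
toPoly₂ (e ⊞ e′) = toPoly₂ e ⊕ toPoly₂ e′
toPoly₂ (e ⊠ e′) = toPoly₂ e ⊗ toPoly₂ e′

-- The truncated s ∸ 1 and t ∸ 1 agree with s − 1 and t − 1 only because s, t ≥ 1.
⟦⟧-toPoly₂ : ∀ {s t} → s ≥ 1 → t ≥ 1 → ∀ e → + ⟦ e ⟧ s t ≡ eval (toPoly₂ e) (+ s) (+ t)
⟦⟧-toPoly₂ _ _ (con n) = refl
⟦⟧-toPoly₂ _ _ (ord σ₁) = refl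
⟦⟧-toPoly₂ _ _ (ord σ₂) = refl
⟦⟧-toPoly₂ _ (s≤s z≤n) (ord∸1 σ₁) = refl
⟦⟧-toPoly₂ (s≤s z≤n) _ (ord∸1 σ₂) = refl
⟦⟧-toPoly₂ {s} {t} s≥1 t≥1 (e ⊞ e′) =
  trans (ℤ.pos-+ (⟦ e ⟧ s t) (⟦ e′ ⟧ s t))
        (cong₂ ℤ._+_ (⟦⟧-toPoly₂ s≥1 t≥1 e) (⟦⟧-toPoly₂ s≥1 t≥1 e′))
⟦⟧-toPoly₂ {s} {t} s≥1 t≥1 (e ⊠ e′) =
  trans (ℤ.pos-* (⟦ e ⟧ s t) (⟦ e′ ⟧ s t))
        (cong₂ ℤ._*_ (⟦⟧-toPoly₂ s≥1 t≥1 e) (⟦⟧-toPoly₂ s≥1 t≥1 e′))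

panelCoeff : Gen → Fin 8 → Fin 8 → Expr
panelCoeff a k l =
  if ascends a k
  then (if does (l ≟ a · k) then ord a else con 0)
  else (if does (l ≟ a · k) then con 1 else if does (l ≟ k) then ord∸1 a else con 0)

-- The factor for the shorter word comes first so that for words of length one the Kronecker
-- delta annihilates the other factor by evaluation, as p₁₂⁴≢p₂₁⁴ needs.
intersectionExpr : ∀ {i} → ReducedWord i → Fin 8 → Fin 8 → Expr
intersectionExpr [] j k = if does (j ≟ k) then con 1 else con 0
intersectionExpr (a ∷ w) j k = ∑ λ l → intersectionExpr w j l ⊠ panelCoeff a k l

intersectionNumber : Fin 8 → Fin 8 → Fin 8 → Expr
intersectionNumber i = intersectionExpr (reducedWord i)

p₁₂⁴≢p₂₁⁴ : ∀ s t →
            ⟦ intersectionNumber r₁ r₂ r₄ ⟧ s t ≢ ⟦ intersectionNumber r₂ r₁ r₄ ⟧ s t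
p₁₂⁴≢p₂₁⁴ s t ()

module Flags {s t : ℕ} (S : GQ s t) where
  open GQ S

  flag : (p : Fin np) (L : Fin nl) → p I L → Flag
  flag p L p∈L = (p , L) , p∈L

  incident : (f : Flag) → pt f I ln f
  incident = proj₂

  flag-≡ : ∀ {f g : Flag} → pt f ≡ pt g → ln f ≡ ln g → f ≡ g
  flag-≡ {(p , L) , p∈L} {(.p , .L) , p∈L′} refl refl = cong (flag p L) (T-irrelevant p∈L p∈L′)

  _≟ᶠ_ : DecidableEquality Flag
  f ≟ᶠ g with pt f ≟ pt g | ln f ≟ ln g
  ... | yes p≡ | yes L≡ = yes (flag-≡ p≡ L≡)
  ... | no p≢ | _ = no (p≢ ∘ cong pt)
  ... | _ | no L≢ = no (L≢ ∘ cong ln)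

  _I?_ : ∀ p L → Dec (p I L)
  p I? L = T? (inc p L)

  I-respˡ : ∀ {p q L} → p ≡ q → p I L → q I L
  I-respˡ refl p∈L = p∈L

  I-respʳ : ∀ {p L M} → L ≡ M → p I L → p I M
  I-respʳ refl p∈L = p∈L

  line-unique : ∀ {p q L M} → p ≢ q → p I L → q I L → p I M → q I M → L ≡ M
  line-unique p≢q = two-points _ _ p≢q _ _

  point-unique : ∀ {L M p q} → L ≢ M → p I L → p I M → q I L → q I M → p ≡ q
  point-unique L≢M = two-lines _ _ L≢M _ _

  projection-unique : ∀ {p L q M q′ M′} → ¬ (p I L) →
                      p I M → q I M → q I L → p I M′ → q′ I M′ → q′ I L → q ≡ q′ × M ≡ M′
  projection-unique {p} {L} p∉L p∈M q∈M q∈L p∈M′ q′∈M′ q′∈L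
    with _ , _ , unique ← gq-axiom p L p∉L
    with q≡ , M≡ ← unique _ _ p∈M q∈M q∈L | q′≡ , M′≡ ← unique _ _ p∈M′ q′∈M′ q′∈L
    = trans q≡ (sym q′≡) , trans M≡ (sym M′≡)

  -- Only the pairs i < j are treated; for the others the first hypothesis evaluates to ⊥.
  exclusive : ∀ i j x y → T (toℕ i <ᵇ toℕ j) → Rel i x y → Rel j x y → ⊥
  exclusive r₀ r₁ x .x _ refl (_ , L≢) = L≢ refl
  exclusive r₀ r₂ x .x _ refl (_ , p≢) = p≢ refl
  exclusive r₀ r₃ x .x _ refl (p≢ , _) = p≢ refl
  exclusive r₀ r₄ x .x _ refl (p≢ , _) = p≢ refl
  exclusive r₀ r₅ x .x _ refl (p≢ , _) = p≢ refl
  exclusive r₀ r₆ x .x _ refl (L≢ , _) = L≢ refl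
  exclusive r₀ r₇ x .x _ refl (¬concurrent , _) = ¬concurrent (pt x , incident x , incident x)
  exclusive r₁ r₂ x y _ (_ , L≢) (L≡ , _) = L≢ L≡
  exclusive r₁ r₃ x y _ (p≡ , _) (p≢ , _) = p≢ p≡
  exclusive r₁ r₄ x y _ (p≡ , _) (p≢ , _) = p≢ p≡
  exclusive r₁ r₅ x y _ (p≡ , _) (p≢ , _) = p≢ p≡
  exclusive r₁ r₆ x y _ (p≡ , L≢) (_ , r , r∈x , r∈y , r≢x , _) =
    r≢x (point-unique L≢ r∈x r∈y (incident x) (I-respˡ (sym p≡) (incident y)))
  exclusive r₁ r₇ x y _ (p≡ , _) (_ , ¬collinear) =
    ¬collinear (ln x , incident x , I-respˡ p≡ (incident x))
  exclusive r₂ r₃ x y _ (L≡ , _) (_ , _ , L≢) = L≢ (sym L≡)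
  exclusive r₂ r₄ x y _ (L≡ , _) (_ , _ , L≢) = L≢ L≡
  exclusive r₂ r₅ x y _ (L≡ , _) (p≢ , N , x∈N , y∈N , N≢x , _) =
    N≢x (line-unique p≢ x∈N y∈N (incident x) (I-respʳ (sym L≡) (incident y)))
  exclusive r₂ r₆ x y _ (L≡ , _) (L≢ , _) = L≢ L≡
  exclusive r₂ r₇ x y _ (L≡ , _) (_ , ¬collinear) =
    ¬collinear (ln x , incident x , I-respʳ (sym L≡) (incident y))
  exclusive r₃ r₄ x y _ (p≢ , y∈x , L≢) (_ , x∈y , _) =
    L≢ (line-unique p≢ x∈y (incident y) (incident x) y∈x)
  exclusive r₃ r₅ x y _ (p≢ , y∈x , _) (_ , N , x∈N , y∈N , N≢x , _) =
    N≢x (line-unique p≢ x∈N y∈N (incident x) y∈x)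
  exclusive r₃ r₆ x y _ (_ , y∈x , _) (L≢ , r , r∈x , r∈y , _ , r≢y) =
    r≢y (point-unique L≢ r∈x r∈y y∈x (incident y))
  exclusive r₃ r₇ x y _ (_ , y∈x , _) (_ , ¬collinear) = ¬collinear (ln x , incident x , y∈x)
  exclusive r₄ r₅ x y _ (p≢ , x∈y , _) (_ , N , x∈N , y∈N , _ , N≢y) =
    N≢y (line-unique p≢ x∈N y∈N x∈y (incident y))
  exclusive r₄ r₆ x y _ (_ , x∈y , _) (L≢ , r , r∈x , r∈y , r≢x , _) =
    r≢x (point-unique L≢ r∈x r∈y (incident x) x∈y)
  exclusive r₄ r₇ x y _ (_ , x∈y , _) (¬concurrent , _) = ¬concurrent (pt x , incident x , x∈y)
  exclusive r₅ r₆ x y _ (p≢ , N , x∈N , y∈N , _) (L≢ , r , r∈x , r∈y , r≢x , r≢y) =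
    r≢x (proj₁ (projection-unique y∉x (incident y) r∈y r∈x y∈N x∈N (incident x)))
    where
    y∉x : ¬ (pt y I ln x)
    y∉x y∈x = r≢y (point-unique L≢ r∈x r∈y y∈x (incident y))
  exclusive r₅ r₇ x y _ (_ , N , x∈N , y∈N , _) (_ , ¬collinear) = ¬collinear (N , x∈N , y∈N)
  exclusive r₆ r₇ x y _ (_ , r , r∈x , r∈y , _) (¬concurrent , _) = ¬concurrent (r , r∈x , r∈y)

  disjoint : ∀ i j x y → Rel i x y → Rel j x y → i ≡ j
  disjoint i j x y Rᵢ Rⱼ with Fin.<-cmp i j
  ... | tri< i<j _ _ = ⊥-elim (exclusive i j x y (<⇒<ᵇ i<j) Rᵢ Rⱼ)
  ... | tri≈ _ i≡j _ = i≡j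
  ... | tri> _ _ j<i = ⊥-elim (exclusive j i x y (<⇒<ᵇ j<i) Rⱼ Rᵢ)

  cover : ∀ x y → ∃[ i ] Rel i x y
  cover x y with pt x ≟ pt y | ln x ≟ ln y
  ... | yes p≡ | yes L≡ = r₀ , flag-≡ p≡ L≡
  ... | yes p≡ | no L≢ = r₁ , p≡ , L≢
  ... | no p≢ | yes L≡ = r₂ , L≡ , p≢
  ... | no p≢ | no L≢ with pt y I? ln x
  ...   | yes y∈x = r₃ , p≢ , y∈x , ≢-sym L≢
  ...   | no y∉x with pt x I? ln y
  ...     | yes x∈y = r₄ , p≢ , x∈y , L≢
  ...     | no x∉y with any? (λ N → (pt x I? N) ×-dec (pt y I? N))
  ...       | yes (N , x∈N , y∈N) =
                r₅ , p≢ , N , x∈N , y∈N ,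
                (λ N≡ → y∉x (I-respʳ N≡ y∈N)) , (λ N≡ → x∉y (I-respʳ N≡ x∈N))
  ...       | no ¬collinear with any? (λ r → (r I? ln x) ×-dec (r I? ln y))
  ...         | yes (r , r∈x , r∈y) =
                  r₆ , L≢ , r , r∈x , r∈y ,
                  (λ r≡ → x∉y (I-respˡ r≡ r∈y)) , (λ r≡ → y∉x (I-respˡ r≡ r∈x))
  ...         | no ¬concurrent = r₇ , ¬concurrent , ¬collinear

  Rel-⁻¹ : ∀ i x y → Rel i x y → Rel (i ⁻¹) y x
  Rel-⁻¹ r₀ x y x≡y = sym x≡y
  Rel-⁻¹ r₁ x y (p≡ , L≢) = sym p≡ , ≢-sym L≢
  Rel-⁻¹ r₂ x y (L≡ , p≢) = sym L≡ , ≢-sym p≢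
  Rel-⁻¹ r₃ x y (p≢ , y∈x , L≢) = ≢-sym p≢ , y∈x , L≢
  Rel-⁻¹ r₄ x y (p≢ , x∈y , L≢) = ≢-sym p≢ , x∈y , L≢
  Rel-⁻¹ r₅ x y (p≢ , N , x∈N , y∈N , N≢x , N≢y) = ≢-sym p≢ , N , y∈N , x∈N , N≢y , N≢x
  Rel-⁻¹ r₆ x y (L≢ , r , r∈x , r∈y , r≢x , r≢y) = ≢-sym L≢ , r , r∈y , r∈x , r≢y , r≢x
  Rel-⁻¹ r₇ x y (¬concurrent , ¬collinear) =
    (λ (r , r∈y , r∈x) → ¬concurrent (r , r∈x , r∈y)) ,
    (λ (N , y∈N , x∈N) → ¬collinear (N , x∈N , y∈N))

  converse : ∀ i → ∃[ j ] (∀ x y → Rel i x y ⇔ Rel j y x)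
  converse i = i ⁻¹ , λ x y →
    mk⇔ (Rel-⁻¹ i x y) (subst (λ k → Rel k x y) (⁻¹-involutive i) ∘ Rel-⁻¹ (i ⁻¹) y x)

  Rel-gen-sym : ∀ a {x y} → Rel (gen a) x y → Rel (gen a) y x
  Rel-gen-sym σ₁ {x} {y} = Rel-⁻¹ r₁ x y
  Rel-gen-sym σ₂ {x} {y} = Rel-⁻¹ r₂ x y

  AscentLaw DescentLaw PanelLaw : Gen → Fin 8 → Flag → Flag → Set
  AscentLaw a k x y = ∀ w → Rel (gen a) x w → Rel (a · k) w y
  -- w₀ is the projection of y onto the a-panel of x.
  DescentLaw a k x y =
    Σ Flag λ w₀ → (Rel (gen a) x w₀ × Rel (a · k) w₀ y) ×
                  (∀ w → Rel (gen a) x w → w ≢ w₀ → Rel k w y)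
  PanelLaw a k x y = if ascends a k then AscentLaw a k x y else DescentLaw a k x y

  σ₁-panelLaw : ∀ k x y → Rel k x y → PanelLaw σ₁ k x y
  σ₁-panelLaw r₀ x .x refl w (p≡ , L≢) = sym p≡ , ≢-sym L≢
  σ₁-panelLaw r₁ x y (p≡ , L≢) =
    y , ((p≡ , L≢) , refl) ,
    λ w (p≡′ , _) w≢y → trans (sym p≡′) p≡ , λ L≡ → w≢y (flag-≡ (trans (sym p≡′) p≡) L≡)
  σ₁-panelLaw r₂ x y (L≡ , p≢) w (p≡ , L≢) =
    (λ p≡′ → p≢ (trans p≡ p≡′)) , I-respˡ p≡ (I-respʳ L≡ (incident x)) ,
    (λ L≡′ → L≢ (trans L≡ (sym L≡′)))
  σ₁-panelLaw r₃ x y (p≢ , y∈x , L≢) w (p≡ , L≢′) =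
    (λ p≡′ → p≢ (trans p≡ p≡′)) , ln x , I-respˡ p≡ (incident x) , y∈x , L≢′ , ≢-sym L≢
  σ₁-panelLaw r₄ x y (p≢ , x∈y , L≢) =
    flag (pt x) (ln y) x∈y , ((refl , L≢) , (refl , p≢)) ,
    λ w (p≡ , _) w≢ →
      (λ p≡′ → p≢ (trans p≡ p≡′)) , I-respˡ p≡ x∈y , (λ L≡ → w≢ (flag-≡ (sym p≡) L≡))
  σ₁-panelLaw r₅ x y (p≢ , N , x∈N , y∈N , N≢x , N≢y) =
    flag (pt x) N x∈N , ((refl , ≢-sym N≢x) , (p≢ , y∈N , ≢-sym N≢y)) ,
    λ w (p≡ , _) w≢ →
      (λ p≡′ → p≢ (trans p≡ p≡′)) , N , I-respˡ p≡ x∈N , y∈N ,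
      (λ N≡ → w≢ (flag-≡ (sym p≡) (sym N≡))) , N≢y
  σ₁-panelLaw r₆ x y (L≢ , r , r∈x , r∈y , r≢x , r≢y) w (p≡ , L≢′) =
    (λ (r′ , r′∈w , r′∈y) →
       L≢′ (proj₂ (projection-unique x∉y (incident x) r∈x r∈y
                                     (I-respˡ (sym p≡) (incident w)) r′∈w r′∈y))) ,
    (λ (N , w∈N , y∈N) →
       r≢y (proj₁ (projection-unique x∉y (incident x) r∈x r∈y
                                     (I-respˡ (sym p≡) w∈N) y∈N (incident y))))
    where
    x∉y : ¬ (pt x I ln y)
    x∉y x∈y = r≢x (sym (point-unique L≢ (incident x) x∈y r∈x r∈y))
  σ₁-panelLaw r₇ x y (¬concurrent , ¬collinear)
    with gq-axiom (pt x) (ln y) (λ x∈y → ¬concurrent (pt x , incident x , x∈y))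
  ... | (r , N) , (x∈N , r∈N , r∈y) , unique =
    flag (pt x) N x∈N ,
    ((refl , (λ L≡ → ¬concurrent (r , I-respʳ (sym L≡) r∈N , r∈y))) ,
     ((λ N≡ → x∉y (I-respʳ N≡ x∈N)) , r , r∈N , r∈y ,
      (λ r≡ → x∉y (I-respˡ r≡ r∈y)) , (λ r≡ → ¬collinear (N , x∈N , I-respˡ r≡ r∈N)))) ,
    λ w (p≡ , _) w≢ →
      (λ (r′ , r′∈w , r′∈y) →
         w≢ (flag-≡ (sym p≡)
                    (proj₂ (unique r′ (ln w) (I-respˡ (sym p≡) (incident w)) r′∈w r′∈y)))) ,
      (λ (M , w∈M , y∈M) → ¬collinear (M , I-respˡ (sym p≡) w∈M , y∈M))
    where
    x∉y : ¬ (pt x I ln y)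
    x∉y x∈y = ¬concurrent (pt x , incident x , x∈y)

  σ₂-panelLaw : ∀ k x y → Rel k x y → PanelLaw σ₂ k x y
  σ₂-panelLaw r₀ x .x refl w (L≡ , p≢) = sym L≡ , ≢-sym p≢
  σ₂-panelLaw r₁ x y (p≡ , L≢) w (L≡ , p≢) =
    (λ p≡′ → p≢ (trans p≡ (sym p≡′))) , I-respʳ L≡ (I-respˡ p≡ (incident x)) ,
    (λ L≡′ → L≢ (trans L≡ (sym L≡′)))
  σ₂-panelLaw r₂ x y (L≡ , p≢) =
    y , ((L≡ , p≢) , refl) ,
    λ w (L≡′ , _) w≢y → trans (sym L≡′) L≡ , λ p≡ → w≢y (flag-≡ p≡ (trans (sym L≡′) L≡))
  σ₂-panelLaw r₃ x y (p≢ , y∈x , L≢) =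
    flag (pt y) (ln x) y∈x , ((refl , p≢) , (refl , ≢-sym L≢)) ,
    λ w (L≡ , _) w≢ →
      (λ p≡ → w≢ (flag-≡ p≡ (sym L≡))) , I-respʳ L≡ y∈x ,
      (λ L≡′ → L≢ (trans L≡′ (sym L≡)))
  σ₂-panelLaw r₄ x y (p≢ , x∈y , L≢) w (L≡ , p≢′) =
    (λ L≡′ → L≢ (trans L≡ L≡′)) , pt x , I-respʳ L≡ (incident x) , x∈y , p≢′ , p≢
  σ₂-panelLaw r₅ x y (p≢ , N , x∈N , y∈N , N≢x , N≢y) w (L≡ , p≢′) =
    (λ (r , r∈w , r∈y) →
       N≢y (proj₂ (projection-unique y∉x y∈N x∈N (incident x)
                                     (incident y) r∈y (I-respʳ (sym L≡) r∈w)))) ,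
    (λ (M , w∈M , y∈M) →
       p≢′ (proj₁ (projection-unique y∉x y∈N x∈N (incident x)
                                     y∈M w∈M (I-respʳ (sym L≡) (incident w)))))
    where
    y∉x : ¬ (pt y I ln x)
    y∉x y∈x = N≢x (line-unique p≢ x∈N y∈N (incident x) y∈x)
  σ₂-panelLaw r₆ x y (L≢ , r , r∈x , r∈y , r≢x , r≢y) =
    flag r (ln x) r∈x , ((refl , ≢-sym r≢x) , (r≢y , r∈y , L≢)) ,
    λ w (L≡ , _) w≢ →
      (λ L≡′ → L≢ (trans L≡ L≡′)) , r , I-respʳ L≡ r∈x , r∈y ,
      (λ r≡ → w≢ (flag-≡ (sym r≡) (sym L≡))) , r≢y
  σ₂-panelLaw r₇ x y (¬concurrent , ¬collinear)
    with gq-axiom (pt y) (ln x) (λ y∈x → ¬collinear (ln x , incident x , y∈x))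
  ... | (r , N) , (y∈N , r∈N , r∈x) , unique =
    flag r (ln x) r∈x ,
    ((refl , (λ p≡ → ¬collinear (N , I-respˡ (sym p≡) r∈N , y∈N))) ,
     ((λ r≡ → y∉x (I-respˡ r≡ r∈x)) , N , r∈N , y∈N ,
      (λ N≡ → y∉x (I-respʳ N≡ y∈N)) , (λ N≡ → ¬concurrent (r , r∈x , I-respʳ N≡ r∈N)))) ,
    λ w (L≡ , _) w≢ →
      (λ (r′ , r′∈w , r′∈y) → ¬concurrent (r′ , I-respʳ (sym L≡) r′∈w , r′∈y)) ,
      (λ (M , w∈M , y∈M) →
         w≢ (flag-≡ (proj₁ (unique (pt w) M y∈M w∈M (I-respʳ (sym L≡) (incident w)))) (sym L≡)))
    where
    y∉x : ¬ (pt y I ln x)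
    y∉x y∈x = ¬collinear (ln x , incident x , y∈x)

  panelLaw : ∀ a k x y → Rel k x y → PanelLaw a k x y
  panelLaw σ₁ = σ₁-panelLaw
  panelLaw σ₂ = σ₂-panelLaw

  ascentLaw : ∀ {a k x y} → T (ascends a k) → PanelLaw a k x y → AscentLaw a k x y
  ascentLaw {a} {k} ascent law with ascends a k
  ... | true = law

  descentLaw : ∀ {a k x y} → ¬ T (ascends a k) → PanelLaw a k x y → DescentLaw a k x y
  descentLaw {a} {k} descent law with ascends a k
  ... | true = ⊥-elim (descent tt)
  ... | false = law

  flagAt : ∀ p L → p I L → HasSize (λ f → pt f ≡ p × ln f ≡ L) 1
  flagAt p L p∈L =
    HasSize-resp (λ f → mk⇔ (λ { refl → refl , refl }) (λ (p≡ , L≡) → flag-≡ p≡ L≡))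
                 (HasSize-singleton (flag p L p∈L))

  flagsThroughPoint : ∀ p {Q : Fin nl → Set} {n} → HasSize (λ L → p I L × Q L) n →
                      HasSize (λ f → pt f ≡ p × Q (ln f)) n
  flagsThroughPoint p {n = n} lines =
    HasSize-resp (λ f → mk⇔ (λ { (L , (_ , q) , p≡ , refl) → p≡ , q })
                            (λ (p≡ , q) → ln f , (I-respˡ p≡ (incident f) , q) , p≡ , refl))
      (subst (HasSize _) (*-identityʳ n)
        (HasSize-Σ {F = λ L f → pt f ≡ p × ln f ≡ L} lines
           (λ L (p∈L , _) → flagAt p L p∈L)
           (λ L L′ f _ _ (_ , L≡) (_ , L′≡) → trans (sym L≡) L′≡)))

  flagsOnLine : ∀ L {Q : Fin np → Set} {n} → HasSize (λ p → p I L × Q p) n →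
                HasSize (λ f → ln f ≡ L × Q (pt f)) n
  flagsOnLine L {n = n} points =
    HasSize-resp (λ f → mk⇔ (λ { (p , (_ , q) , refl , L≡) → L≡ , q })
                            (λ (L≡ , q) → pt f , (I-respʳ L≡ (incident f) , q) , refl , L≡))
      (subst (HasSize _) (*-identityʳ n)
        (HasSize-Σ {F = λ p f → pt f ≡ p × ln f ≡ L} points
           (λ p (p∈L , _) → flagAt p L p∈L)
           (λ p p′ f _ _ (p≡ , _) (p′≡ , _) → trans (sym p≡) p′≡)))

  neighbours : ∀ a x → HasSize (Rel (gen a) x) (order a s t)
  neighbours σ₁ x =
    HasSize-resp (λ f → mk⇔ (λ (p≡ , L≢) → sym p≡ , ≢-sym L≢)
                            (λ (p≡ , L≢) → sym p≡ , ≢-sym L≢))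
      (flagsThroughPoint (pt x) (HasSize-remove _≟_ (ln x) (incident x) (lines-per-point (pt x))))
  neighbours σ₂ x =
    HasSize-resp (λ f → mk⇔ (λ (L≡ , p≢) → sym L≡ , ≢-sym p≢)
                            (λ (L≡ , p≢) → sym L≡ , ≢-sym p≢))
      (flagsOnLine (ln x) (HasSize-remove _≟_ (pt x) (incident x) (points-per-line (ln x))))

  ascentCount : ∀ {a k x y} → AscentLaw a k x y → ∀ l →
                HasSize (λ w → Rel (gen a) x w × Rel l w y)
                        (⟦ if does (l ≟ a · k) then ord a else con 0 ⟧ s t)
  ascentCount {a} {k} {x} {y} law l with l ≟ a · k
  ... | yes refl = HasSize-resp (λ w → mk⇔ (λ Rₐ → Rₐ , law w Rₐ) proj₁) (neighbours a x)
  ... | no l≢a·k = HasSize-∅ (λ w (Rₐ , Rₗ) → l≢a·k (disjoint l (a · k) w y Rₗ (law w Rₐ)))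

  descentCount : ∀ {a k x y} → DescentLaw a k x y → ∀ l →
                 HasSize (λ w → Rel (gen a) x w × Rel l w y)
                   (⟦ if does (l ≟ a · k) then con 1
                      else if does (l ≟ k) then ord∸1 a else con 0 ⟧ s t)
  descentCount {a} {k} {x} {y} (w₀ , (Rₐ₀ , R₀) , others) l with l ≟ a · k
  ... | yes refl =
    HasSize-resp (λ w → mk⇔ (λ { refl → Rₐ₀ , R₀ }) (λ (Rₐ , Rₗ) → is-w₀ w Rₐ Rₗ))
                 (HasSize-singleton w₀)
    where
    is-w₀ : ∀ w → Rel (gen a) x w → Rel (a · k) w y → w ≡ w₀
    is-w₀ w Rₐ Rₗ with w ≟ᶠ w₀
    ... | yes w≡w₀ = w≡w₀
    ... | no w≢w₀ = ⊥-elim (·-fixed-point-free a k (disjoint _ _ w y Rₗ (others w Rₐ w≢w₀)))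
  ... | no l≢a·k with l ≟ k
  ...   | yes refl =
            HasSize-resp (λ w → mk⇔ (λ (Rₐ , w≢w₀) → Rₐ , others w Rₐ w≢w₀)
                                    (λ (Rₐ , Rₗ) → Rₐ , λ { refl →
                                                      l≢a·k (disjoint _ _ w₀ y Rₗ R₀) }))
              (HasSize-remove _≟ᶠ_ w₀ Rₐ₀ (neighbours a x))
  ...   | no l≢k = HasSize-∅ excluded
    where
    excluded : ∀ w → ¬ (Rel (gen a) x w × Rel l w y)
    excluded w (Rₐ , Rₗ) with w ≟ᶠ w₀
    ... | yes refl = l≢a·k (disjoint _ _ w y Rₗ R₀)
    ... | no w≢w₀ = l≢k (disjoint _ _ w y Rₗ (others w Rₐ w≢w₀))

  neighbourCount : ∀ a k l {x y} → Rel k x y →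
                   HasSize (λ w → Rel (gen a) x w × Rel l w y) (⟦ panelCoeff a k l ⟧ s t)
  neighbourCount a k l {x} {y} R with ascends a k | panelLaw a k x y R
  ... | true | law = ascentCount law l
  ... | false | law = descentCount law l

  module Factorisation {a : Gen} {k : Fin 8} (ascent : T (ascends a k)) where

    compose : ∀ {x w z} → Rel (gen a) x w → Rel k w z → Rel (a · k) x z
    compose {x} {w} {z} Rₐ Rₖ = ascentLaw ascent (panelLaw a k w z Rₖ) x (Rel-gen-sym a Rₐ)

    descent : ¬ T (ascends a (a · k))
    descent rewrite ascends-· a k with ascends a k
    ... | true = λ ()

    decompose : ∀ {x z} → Rel (a · k) x z → ∃[ w ] (Rel (gen a) x w × Rel k w z)
    decompose {x} {z} R with descentLaw descent (panelLaw a (a · k) x z R)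
    ... | w₀ , (Rₐ , R′) , _ = w₀ , Rₐ , subst (λ i → Rel i w₀ z) (·-involutive a k) R′

    middle-unique : ∀ {x w w′ z} → Rel (gen a) x w → Rel k w z → Rel (gen a) x w′ → Rel k w′ z →
                    w ≡ w′
    middle-unique {x} {w} {w′} {z} Rₐ Rₖ Rₐ′ Rₖ′
      with w₀ , _ , others ← descentLaw descent (panelLaw a (a · k) x z (compose Rₐ Rₖ)) =
      trans (is-w₀ w Rₐ Rₖ) (sym (is-w₀ w′ Rₐ′ Rₖ′))
      where
      is-w₀ : ∀ v → Rel (gen a) x v → Rel k v z → v ≡ w₀
      is-w₀ v Rₐ Rₖ with v ≟ᶠ w₀
      ... | yes v≡w₀ = v≡w₀
      ... | no v≢w₀ = ⊥-elim (·-fixed-point-free a k (disjoint _ _ v z (others v Rₐ v≢w₀) Rₖ))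

    count : ∀ {j m x y} {c : Fin 8 → ℕ} → Rel m x y →
            (∀ l w → Rel l w y → HasSize (λ z → Rel k w z × Rel j z y) (c l)) →
            HasSize (λ z → Rel (a · k) x z × Rel j z y)
                    (sum (tabulate λ l → c l * ⟦ panelCoeff a m l ⟧ s t))
    count {j} {m} {x} {y} {c} Rₘ fibre =
      HasSize-resp (λ z → mk⇔ (λ (_ , w , (Rₐ , _) , (Rₖ , Rⱼ)) → compose Rₐ Rₖ , Rⱼ) split)
                   (HasSize-∃Fin throughMiddle middles-disjoint)
      where
      Through : Fin 8 → Flag → Set
      Through l z = ∃[ w ] ((Rel (gen a) x w × Rel l w y) × (Rel k w z × Rel j z y))

      throughMiddle : ∀ l → HasSize (Through l) (c l * ⟦ panelCoeff a m l ⟧ s t)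
      throughMiddle l =
        subst (HasSize _) (*-comm _ (c l))
          (HasSize-Σ (neighbourCount a m l Rₘ) (λ w (_ , Rₗ) → fibre l w Rₗ)
             (λ w w′ z (Rₐ , _) (Rₐ′ , _) (Rₖ , _) (Rₖ′ , _) → middle-unique Rₐ Rₖ Rₐ′ Rₖ′))

      middles-disjoint : ∀ l l′ z → Through l z → Through l′ z → l ≡ l′
      middles-disjoint l l′ z (w , (Rₐ , Rₗ) , (Rₖ , _)) (w′ , (Rₐ′ , Rₗ′) , (Rₖ′ , _)) =
        disjoint l l′ w y Rₗ (subst (λ v → Rel l′ v y) (sym (middle-unique Rₐ Rₖ Rₐ′ Rₖ′)) Rₗ′)

      split : ∀ {z} → Rel (a · k) x z × Rel j z y → ∃[ l ] Through l z
      split (Rᵢ , Rⱼ) with w , Rₐ , Rₖ ← decompose Rᵢ with l , Rₗ ← cover w y =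
        l , w , (Rₐ , Rₗ) , (Rₖ , Rⱼ)

  intersectionCount : ∀ {i} (w : ReducedWord i) j k {x y} → Rel k x y →
                      HasSize (λ z → Rel i x z × Rel j z y) (⟦ intersectionExpr w j k ⟧ s t)
  intersectionCount [] j k {x} {y} R with j ≟ k
  ... | yes refl =
    HasSize-resp (λ z → mk⇔ (λ { refl → refl , R }) (sym ∘ proj₁)) (HasSize-singleton x)
  ... | no j≢k = HasSize-∅ λ { z (refl , Rⱼ) → j≢k (disjoint j k x y Rⱼ R) }
  intersectionCount (_∷_ a {ascent} w) j k R =
    subst (HasSize _) (sym (⟦∑⟧ (λ l → intersectionExpr w j l ⊠ panelCoeff a k l) s t))
      (Factorisation.count ascent R (λ l _ Rₗ → intersectionCount w j l Rₗ))

  -- Every point lies on L₀ or is collinear with exactly one point of L₀.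
  pointCount : Fin nl → HasSize (λ (p : Fin np) → ⊤) (suc s * (1 + t * s))
  pointCount L₀ =
    HasSize-resp (λ p → mk⇔ _ (λ _ → foot p)) (HasSize-Σ (points-per-line L₀) fibre fibres-disjoint)
    where
    Foot : Fin np → Fin np → Set
    Foot r p = p ≡ r ⊎ ∃[ N ] ((r I N × N ≢ L₀) × (p I N × p ≢ r))

    fibre : ∀ r → r I L₀ → HasSize (Foot r) (1 + t * s)
    fibre r r∈L₀ =
      HasSize-⊎ (HasSize-singleton r)
        (HasSize-Σ (HasSize-remove _≟_ L₀ r∈L₀ (lines-per-point r))
           (λ N (r∈N , _) → HasSize-remove _≟_ r r∈N (points-per-line N))
           (λ N N′ p (r∈N , _) (r∈N′ , _) (p∈N , p≢r) (p∈N′ , _) →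
              line-unique p≢r p∈N r∈N p∈N′ r∈N′))
        (λ p p≡r (_ , _ , _ , p≢r) → p≢r p≡r)

    fibres-disjoint : ∀ r r′ p → r I L₀ → r′ I L₀ → Foot r p → Foot r′ p → r ≡ r′
    fibres-disjoint r r′ p _ _ (inj₁ p≡r) (inj₁ p≡r′) = trans (sym p≡r) p≡r′
    fibres-disjoint r r′ p r∈L₀ r′∈L₀ (inj₁ refl)
                                      (inj₂ (N , (r′∈N , N≢L₀) , (p∈N , p≢r′))) =
      ⊥-elim (N≢L₀ (line-unique p≢r′ p∈N r′∈N r∈L₀ r′∈L₀))
    fibres-disjoint r r′ p r∈L₀ r′∈L₀ (inj₂ (N , (r∈N , N≢L₀) , (p∈N , p≢r)))
                                      (inj₁ refl) =
      ⊥-elim (N≢L₀ (line-unique p≢r p∈N r∈N r′∈L₀ r∈L₀))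
    fibres-disjoint r r′ p r∈L₀ r′∈L₀ (inj₂ (N , (r∈N , N≢L₀) , (p∈N , p≢r)))
                                      (inj₂ (N′ , (r′∈N′ , _) , (p∈N′ , _))) =
      proj₁ (projection-unique (λ p∈L₀ → N≢L₀ (line-unique p≢r p∈N r∈N p∈L₀ r∈L₀))
                               p∈N r∈N r∈L₀ p∈N′ r′∈N′ r′∈L₀)

    foot : ∀ p → ∃[ r ] (r I L₀ × Foot r p)
    foot p with p I? L₀
    ... | yes p∈L₀ = p , p∈L₀ , inj₁ refl
    ... | no p∉L₀ with (r , N) , (p∈N , r∈N , r∈L₀) , _ ← gq-axiom p L₀ p∉L₀ =
      r , r∈L₀ ,
      inj₂ (N , (r∈N , λ N≡ → p∉L₀ (I-respʳ N≡ p∈N)) ,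
                (p∈N , λ p≡ → p∉L₀ (I-respˡ (sym p≡) r∈L₀)))

  flagCount : HasSize (λ (f : Flag) → ⊤) (suc s * suc t * suc (s * t))
  flagCount =
    subst (HasSize _) (arithmetic s t)
      (HasSize-resp (λ f → mk⇔ _ (λ _ → pt f , tt , refl , tt))
        (HasSize-Σ (pointCount (fromℕ< lines-nonempty)) flagsAt
                   (λ p p′ f _ _ (p≡ , _) (p′≡ , _) → trans (sym p≡) p′≡)))
    where
    flagsAt : ∀ p → ⊤ → HasSize (λ f → pt f ≡ p × ⊤) (suc t)
    flagsAt p _ = flagsThroughPoint p (HasSize-resp (λ L → mk⇔ (_, tt) proj₁) (lines-per-point p))

    arithmetic : ∀ s t → suc s * (1 + t * s) * suc t ≡ suc s * suc t * suc (s * t)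
    arithmetic = solve 2 (λ s t → (con 1 :+ s) :* (con 1 :+ t :* s) :* (con 1 :+ t)
                                := (con 1 :+ s) :* (con 1 :+ t) :* (con 1 :+ s :* t)) refl
      where open +-*-Solver

  module _ (s≥1 : s ≥ 1) (t≥1 : t ≥ 1) where

    some-neighbour : ∀ a x → ∃[ w ] Rel (gen a) x w
    some-neighbour σ₁ x = HasSize-witness (neighbours σ₁ x) t≥1
    some-neighbour σ₂ x = HasSize-witness (neighbours σ₂ x) s≥1

    some-flag : Flag
    some-flag =
      let p = fromℕ< points-nonempty
          (L , p∈L) = HasSize-witness (lines-per-point p) (s≤s z≤n)
      in flag p L p∈L

    related : ∀ {i} → ReducedWord i → ∃[ x ] ∃[ y ] Rel i x y
    related [] = some-flag , some-flag , refl
    related (_∷_ a {ascent} w) with y , z , R ← related w with x , Rₐ ← some-neighbour a y =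
      x , z , Factorisation.compose ascent (Rel-gen-sym a Rₐ) R

    isAssociationScheme : IsAssociationScheme 7 Rel
    isAssociationScheme = record
      { cover     = cover
      ; disjoint  = disjoint
      ; nonempty  = λ i → related (reducedWord i)
      ; diagonal  = λ _ _ → ⇔.refl
      ; converse  = converse
      ; p         = λ i j k → ⟦ intersectionNumber i j k ⟧ s t
      ; p-correct = λ i j k x y → intersectionCount (reducedWord i) j k
      }

    samePoint : Fin 8 → Bool
    samePoint r₀ = true
    samePoint r₁ = true
    samePoint _  = false

    SamePoint : Flag → Flag → Set
    SamePoint x y = ∃[ i ] (T (samePoint i) × Rel i x y)

    SamePoint⇒≡ : ∀ {x y} → SamePoint x y → pt x ≡ pt y
    SamePoint⇒≡ (r₀ , _ , refl) = refl
    SamePoint⇒≡ (r₁ , _ , p≡ , _) = p≡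

    ≡⇒SamePoint : ∀ {x y} → pt x ≡ pt y → SamePoint x y
    ≡⇒SamePoint {x} {y} p≡ with ln x ≟ ln y
    ... | yes L≡ = r₀ , tt , flag-≡ p≡ L≡
    ... | no L≢ = r₁ , tt , p≡ , L≢

    imprimitive : Imprimitive 7 Rel
    imprimitive =
      samePoint ,
      (λ diagonal → let (w , p≡ , L≢) = some-neighbour σ₁ some-flag
                    in L≢ (cong ln (to (diagonal some-flag w) (≡⇒SamePoint p≡)))) ,
      (λ total → let (w , _ , p≢) = some-neighbour σ₂ some-flag
                 in p≢ (SamePoint⇒≡ (total some-flag w))) ,
      (λ x → ≡⇒SamePoint refl) ,
      (λ x y x~y → ≡⇒SamePoint (sym (SamePoint⇒≡ x~y))) ,
      (λ x y z x~y y~z → ≡⇒SamePoint (trans (SamePoint⇒≡ x~y) (SamePoint⇒≡ y~z)))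

mainTheorem1 : Σ (Fin 8 → Fin 8 → Fin 8 → Poly₂) λ P →
    ∀ (s t : ℕ) → s ≥ 1 → t ≥ 1 → (S : GQ s t) →
    Σ (IsAssociationScheme 7 (GQ.Rel S)) λ AS →
    IsAssociationScheme.HasOrder AS (suc s * suc t * suc (s * t))
    × ¬ IsAssociationScheme.Commutative AS
    × Imprimitive 7 (GQ.Rel S)
    × (∀ i j k → + (IsAssociationScheme.p AS i j k) ≡ eval (P i j k) (+ s) (+ t))
mainTheorem1 =
  (λ i j k → toPoly₂ (intersectionNumber i j k)) ,
  λ s t s≥1 t≥1 S → let open Flags S in
    isAssociationScheme s≥1 t≥1 ,
    flagCount ,
    (λ commutative → p₁₂⁴≢p₂₁⁴ s t (commutative r₁ r₂ r₄)) ,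
    imprimitive s≥1 t≥1 ,
    λ i j k → ⟦⟧-toPoly₂ s≥1 t≥1 (intersectionNumber i j k)
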